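{- Let $\mathsf L$ be any of $\mathsf{K45}_n\mathbf D$, $\mathsf{KD45}_n\mathbf D$, $\mathsf{S5}_n\mathbf D$, let $P\subseteq\mathcal P$ be finite and $p\in P$. For every $\delta\in D^P_1(\mathsf L)$, $\delta^p$ is a result of forgetting $p$ in $\delta$ in $\mathsf L$.
   Context: $\mathcal A$ is a finite set of $n$ agents, $\mathcal P$ a countable set of atoms, $\mathcal P^+(\mathcal A)$ the nonempty subsets of $\mathcal A$. Models $(S,R,V)$: $\mathbf D_{\mathcal B}$ is the box for $R_{\mathcal B}=\bigcap_{i\in\mathcal B}R_i$, $\hat{\mathbf D}_{\mathcal B}=\neg\mathbf D_{\mathcal B}\neg$. $\mathsf{K45}_n\mathbf D$-, $\mathsf{KD45}_n\mathbf D$-, $\mathsf{S5}_n\mathbf D$-models: models whose $R_i$ are respectively transitive and Euclidean; serial, transitive and Euclidean; reflexive, transitive and Euclidean. $\nabla_{\mathcal B}\Phi=\mathbf D_{\mathcal B}(\bigvee\Phi)\wedge\bigwedge\{\hat{\mathbf D}_{\mathcal B}\phi\mid\phi\in\Phi\}$. $D^P_0$: minterms of $P$; $D^P_1$: formulas $\delta_0\wedge\bigwedge_{\mathcal B\in\mathcal P^+(\mathcal A)}\nabla_{\mathcal B}\Phi_{\mathcal B}$ with $\delta_0\in D^P_0$, $\Phi_{\mathcal B}\subseteq D^P_0$; $D^P_1(\mathsf L)$: those true in some $\mathsf L$-model. $\delta^p$: replace every occurrence of $\neg p$ in $\delta$ by $\top$, then every remaining $p$ by $\top$. Collective $p$-bisimilarity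 of $(M,s),(M',s')$: a relation $\rho\ni(s,s')$ such that related worlds agree on atoms other than $p$ and, for every $\mathcal C\in\mathcal P^+(\mathcal A)$, every $R_{\mathcal C}$-successor of one related world is $\rho$-related to an $R'_{\mathcal C}$-successor of the other, and vice versa. $\psi$ (atoms among those of $\phi$ except $p$) is a result of forgetting $p$ in $\phi$ in $\mathsf L$ if every $\mathsf L$-model collectively $p$-bisimilar to an $\mathsf L$-model of $\phi$ satisfies $\psi$, and every $\mathsf L$-model of $\psi$ is collectively $p$-bisimilar to some $\mathsf L$-model of $\phi$. -}

module Defs where

open import Data.Nat using (ℕ; zero; suc; _≡ᵇ_)
open import Data.Bool using (Bool; true; false; if_then_else_)
open import Data.Fin using (Fin)
open import Data.Fin.Subset using (Subset; Nonempty) renaming (_∈_ to _∈ₛ_)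
open import Data.Vec using (Vec; []; _∷_)
open import Data.List using (List; []; _∷_; map; _++_; foldr)
open import Data.List.Relation.Unary.All using (All)
open import Data.Product using (Σ; ∃; _×_; _,_)
open import Data.Unit using (⊤)
open import Data.Sum using (_⊎_)
open import Data.Empty using (⊥)
open import Relation.Nullary using (¬_)
open import Relation.Binary.PropositionalEquality using (_≡_; _≢_)

infixr 6 _∧_
infixr 5 _∨_

data Formula (n : ℕ) : Set where
  atom : ℕ → Formula n
  ⊤ᶠ   : Formula n
  ⊥ᶠ   : Formula n
  ¬ᶠ_  : Formula n → Formula n
  _∧_  : Formula n → Formula n → Formula n
  _∨_  : Formula n → Formula n → Formula n
  D    : Subset n → Formula n → Formula n
  D̂    : Subset n → Formula n → Formula n

⋀ : ∀ {n} → List (Formula n) → Formula n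
⋀ = foldr _∧_ ⊤ᶠ

⋁ : ∀ {n} → List (Formula n) → Formula n
⋁ = foldr _∨_ ⊥ᶠ

∇ : ∀ {n} → Subset n → List (Formula n) → Formula n
∇ B Φ = D B (⋁ Φ) ∧ ⋀ (map (D̂ B) Φ)

record Model (n : ℕ) : Set₁ where
  field
    S : Set
    R : Fin n → S → S → Set
    V : S → ℕ → Bool

open Model public

RG : ∀ {n} (M : Model n) → Subset n → S M → S M → Set
RG M B s t = ∀ i → i ∈ₛ B → R M i s t

_,_⊨_ : ∀ {n} (M : Model n) → S M → Formula n → Set
M , s ⊨ atom q = V M s q ≡ true
M , s ⊨ ⊤ᶠ = ⊤
M , s ⊨ ⊥ᶠ = ⊥
M , s ⊨ (¬ᶠ φ) = ¬ (M , s ⊨ φ)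
M , s ⊨ (φ ∧ ψ) = (M , s ⊨ φ) × (M , s ⊨ ψ)
M , s ⊨ (φ ∨ ψ) = (M , s ⊨ φ) ⊎ (M , s ⊨ ψ)
M , s ⊨ D B φ = ∀ t → RG M B s t → M , t ⊨ φ
M , s ⊨ D̂ B φ = ∃ λ t → RG M B s t × (M , t ⊨ φ)

Transitive Euclidean Serial Reflexive : ∀ {n} → Model n → Set
Transitive M = ∀ i s t u → R M i s t → R M i t u → R M i s u
Euclidean  M = ∀ i s t u → R M i s t → R M i s u → R M i t u
Serial     M = ∀ i s → ∃ λ t → R M i s t
Reflexive  M = ∀ i s → R M i s s

data Logic : Set where
  K45nD KD45nD S5nD : Logic

IsModelOf : ∀ {n} → Logic → Model n → Set
IsModelOf K45nD  M = Transitive M × Euclidean M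
IsModelOf KD45nD M = Serial M × Transitive M × Euclidean M
IsModelOf S5nD   M = Reflexive M × Transitive M × Euclidean M

literal : ∀ {n} → Bool → ℕ → Formula n
literal true  q = atom q
literal false q = ¬ᶠ atom q

minterm : ∀ {n} → List ℕ → (ℕ → Bool) → Formula n
minterm P v = ⋀ (map (λ q → literal (v q) q) P)

IsMinterm : ∀ {n} → List ℕ → Formula n → Set
IsMinterm P δ = ∃ λ v → δ ≡ minterm P v

allSubsets : (n : ℕ) → List (Subset n)
allSubsets zero    = [] ∷ []
allSubsets (suc n) = map (true ∷_) (allSubsets n) ++ map (false ∷_) (allSubsets n)

nonemptySubsets : (n : ℕ) → List (Subset n)
nonemptySubsets zero    = []
nonemptySubsets (suc n) = map (true ∷_) (allSubsets n) ++ map (false ∷_) (nonemptySubsets n)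

d1Formula : ∀ {n} → Formula n → (Subset n → List (Formula n)) → Formula n
d1Formula {n} δ₀ Φ = δ₀ ∧ ⋀ (map (λ B → ∇ B (Φ B)) (nonemptySubsets n))

InD1 : ∀ {n} → List ℕ → Formula n → Set
InD1 P δ = ∃ λ δ₀ → ∃ λ Φ →
  IsMinterm P δ₀ × (∀ B → All (IsMinterm P) (Φ B)) × δ ≡ d1Formula δ₀ Φ

Satisfiable : ∀ {n} → Logic → Formula n → Set₁
Satisfiable L φ = Σ (Model _) λ M → IsModelOf L M × ∃ λ s → M , s ⊨ φ

InD1L : ∀ {n} → Logic → List ℕ → Formula n → Set₁
InD1L L P δ = InD1 P δ × Satisfiable L δ

_^ᵖ_ : ∀ {n} → Formula n → ℕ → Formula n
atom q ^ᵖ p = if q ≡ᵇ p then ⊤ᶠ else atom q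
⊤ᶠ ^ᵖ p = ⊤ᶠ
⊥ᶠ ^ᵖ p = ⊥ᶠ
(¬ᶠ atom q) ^ᵖ p = if q ≡ᵇ p then ⊤ᶠ else ¬ᶠ atom q
(¬ᶠ φ) ^ᵖ p = ¬ᶠ (φ ^ᵖ p)
(φ ∧ ψ) ^ᵖ p = (φ ^ᵖ p) ∧ (ψ ^ᵖ p)
(φ ∨ ψ) ^ᵖ p = (φ ^ᵖ p) ∨ (ψ ^ᵖ p)
D B φ ^ᵖ p = D B (φ ^ᵖ p)
D̂ B φ ^ᵖ p = D̂ B (φ ^ᵖ p)

data Occurs {n} (q : ℕ) : Formula n → Set where
  here : Occurs q (atom q)
  neg  : ∀ {φ} → Occurs q φ → Occurs q (¬ᶠ φ)
  andˡ : ∀ {φ ψ} → Occurs q φ → Occurs q (φ ∧ ψ)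
  andʳ : ∀ {φ ψ} → Occurs q ψ → Occurs q (φ ∧ ψ)
  orˡ  : ∀ {φ ψ} → Occurs q φ → Occurs q (φ ∨ ψ)
  orʳ  : ∀ {φ ψ} → Occurs q ψ → Occurs q (φ ∨ ψ)
  box  : ∀ {B φ} → Occurs q φ → Occurs q (D B φ)
  dia  : ∀ {B φ} → Occurs q φ → Occurs q (D̂ B φ)

record CollBisim {n} (p : ℕ) (M M' : Model n) (s : S M) (s' : S M') : Set₁ where
  field
    ρ     : S M → S M' → Set
    start : ρ s s'
    atoms : ∀ {u u'} → ρ u u' → ∀ q → q ≢ p → V M u q ≡ V M' u' q
    forth : ∀ {u u'} → ρ u u' → ∀ C → Nonempty C → ∀ t → RG M C u t →
              ∃ λ t' → RG M' C u' t' × ρ t t'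
    back  : ∀ {u u'} → ρ u u' → ∀ C → Nonempty C → ∀ t' → RG M' C u' t' →
              ∃ λ t → RG M C u t × ρ t t'

IsForgetting : ∀ {n} → Logic → ℕ → Formula n → Formula n → Set₁
IsForgetting {n} L p φ ψ =
  (∀ q → Occurs q ψ → Occurs q φ × q ≢ p)
  × (∀ (M : Model n) (s : S M) (M' : Model n) (s' : S M') →
       IsModelOf L M → M , s ⊨ φ → IsModelOf L M' → CollBisim p M M' s s' →
       M' , s' ⊨ ψ)
  × (∀ (M' : Model n) (s' : S M') → IsModelOf L M' → M' , s' ⊨ ψ →
       Σ (Model n) λ M → Σ (S M) λ s →
         IsModelOf L M × (M , s ⊨ φ) × CollBisim p M M' s s')

{-# OPTIONS --safe #-}
module Submission where

-- A D₁ formula δ = δ₀ ∧ ⋀_B ∇_B Φ_B is in negation normal form with modalities over nonempty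
-- groups only, so its truth passes to δ^p along any collective p-bisimulation.
--
-- Conversely, let M', s' ⊨ δ^p. Take copies of the worlds y of M' tagged either by a group G with
-- s' R'_G y, or as untouched, or (for y = s') as the root, and let copies be R_i-related when the
-- worlds are R'_i-related and the tags agree on containing i. Agreement is an equivalence relation,
-- so transitivity, euclideanness, seriality and reflexivity off the root survive, and forgetting
-- the tags is a collective p-bisimulation. On a copy tagged G, p is reset so that the copy satisfies
-- a minterm of Φ_G, which s' ⊨ D_G (⋁Φ_G)^p allows. The R_C-successors of the root are the copies
-- tagged G ⊇ C, and they satisfy ⋁Φ_C because any model of δ forces Φ_G ⊆ Φ_C when ∅ ≠ C ⊆ G.

open import Defs
open import Function using (_∘_; id)
open import Data.Nat using (ℕ; zero; suc; _≡ᵇ_)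
open import Data.Nat.Properties using (≡ᵇ⇒≡; ≡⇒≡ᵇ)
open import Data.Bool using (Bool; true; false; T; if_then_else_) renaming (_∧_ to _∧ᵇ_)
open import Data.Bool.Properties using (¬-not; not-¬)
open import Data.Fin using (Fin; zero; suc)
open import Data.Fin.Subset using (Subset; Nonempty; _⊆_; _∩_; ⁅_⁆) renaming (_∈_ to _∈ₛ_; ⊤ to full)
open import Data.Fin.Subset.Properties using (nonempty?; x∈⁅x⁆; x∈⁅y⁆⇒x≡y; p∩q⊆p; p∩q⊆q; x∈p∩q⁺; ∈⊤)
open import Data.Vec using ([]; _∷_; lookup; here; there)
open import Data.Vec.Properties using ([]=⇒lookup; lookup⇒[]=; lookup-zipWith; lookup-replicate)
open import Data.List using (List; []; _∷_; map)
open import Data.List.Properties using (map-cong; map-∘)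
open import Data.List.Membership.Propositional using (_∈_; find; lose)
open import Data.List.Membership.Propositional.Properties using (∈-map⁺; ∈-map⁻; ∈-++⁺ˡ; ∈-++⁺ʳ; ∈-++⁻)
open import Data.List.Relation.Unary.Any as Any using (Any; here; there)
import Data.List.Relation.Unary.Any.Properties as Anyₚ
open import Data.List.Relation.Unary.All as All using (All; []; _∷_)
import Data.List.Relation.Unary.All.Properties as Allₚ
open import Data.Product as Product using (Σ; ∃; ∃₂; _×_; _,_; proj₁; proj₂; map₁; uncurry)
import Data.Sum as Sum
open import Data.Sum using (inj₁; inj₂)
open import Data.Unit using (tt) renaming (⊤ to Unit)
open import Data.Empty using (⊥; ⊥-elim)
open import Relation.Nullary using (¬_; yes; no)
open import Relation.Binary.PropositionalEquality using (_≡_; _≢_; refl; sym; trans; cong; cong₂; subst; module ≡-Reasoning)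

private
  variable
    n : ℕ
    p q : ℕ
    b : Bool
    B : Subset n
    Q : List ℕ
    W W₁ W₂ W₃ v : ℕ → Bool
    vs : List (ℕ → Bool)
    δ₀ : Formula n
    φs : List (Formula n)
    Φ : Subset n → List (Formula n)
    M : Model n

≡ᵇ-true⇒≡ : (q ≡ᵇ p) ≡ true → q ≡ p
≡ᵇ-true⇒≡ {q} {p} eq = ≡ᵇ⇒≡ q p (subst T (sym eq) tt)

≡ᵇ-false⇒≢ : (q ≡ᵇ p) ≡ false → q ≢ p
≡ᵇ-false⇒≢ {q} {p} eq q≡p = subst T eq (≡⇒≡ᵇ q p q≡p)

≢⇒≡ᵇ-false : q ≢ p → (q ≡ᵇ p) ≡ false
≢⇒≡ᵇ-false q≢p = ¬-not (q≢p ∘ ≡ᵇ-true⇒≡)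

∈-allSubsets : (B : Subset n) → B ∈ allSubsets n
∈-allSubsets []          = here refl
∈-allSubsets (true ∷ B)  = ∈-++⁺ˡ (∈-map⁺ (true ∷_) (∈-allSubsets B))
∈-allSubsets (false ∷ B) = ∈-++⁺ʳ _ (∈-map⁺ (false ∷_) (∈-allSubsets B))

∈-nonemptySubsets : Nonempty B → B ∈ nonemptySubsets n
∈-nonemptySubsets {B = []}        (() , _)
∈-nonemptySubsets {B = true ∷ B}  _ = ∈-++⁺ˡ (∈-map⁺ (true ∷_) (∈-allSubsets B))
∈-nonemptySubsets {B = false ∷ B} (suc i , there i∈B) =
  ∈-++⁺ʳ _ (∈-map⁺ (false ∷_) (∈-nonemptySubsets (i , i∈B)))

nonemptySubsets-nonempty : B ∈ nonemptySubsets n → Nonempty B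
nonemptySubsets-nonempty {n = suc n} B∈ with ∈-++⁻ (map (true ∷_) (allSubsets n)) B∈
... | inj₁ B∈ₜ with ∈-map⁻ (true ∷_) B∈ₜ
...   | _ , _ , refl = zero , here
nonemptySubsets-nonempty {n = suc n} B∈ | inj₂ B∈f with ∈-map⁻ (false ∷_) B∈f
...   | _ , B′∈ , refl = Product.map suc there (nonemptySubsets-nonempty B′∈)

R⇒RG-⁅⁆ : ∀ {i x y} → R M i x y → RG M ⁅ i ⁆ x y
R⇒RG-⁅⁆ {M = M} {i} {x} {y} r j j∈ = subst (λ k → R M k x y) (sym (x∈⁅y⁆⇒x≡y i j∈)) r

infixl 9 _[_≔_]
infix 4 _≈[_]_ _∈[_]_

_[_≔_] : (ℕ → Bool) → ℕ → Bool → ℕ → Bool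
W [ p ≔ b ] = λ q → if q ≡ᵇ p then b else W q

[≔]-≢ : q ≢ p → (W [ p ≔ b ]) q ≡ W q
[≔]-≢ {q} {p} q≢p rewrite ≢⇒≡ᵇ-false q≢p = refl

_≈[_]_ : (ℕ → Bool) → List ℕ → (ℕ → Bool) → Set
W ≈[ Q ] v = All (λ q → W q ≡ v q) Q

≈-sym : W₁ ≈[ Q ] W₂ → W₂ ≈[ Q ] W₁
≈-sym = All.map sym

≈-trans : W₁ ≈[ Q ] W₂ → W₂ ≈[ Q ] W₃ → W₁ ≈[ Q ] W₃
≈-trans e₁ e₂ = All.zipWith (uncurry trans) (e₁ , e₂)

_∈[_]_ : (ℕ → Bool) → List ℕ → List (ℕ → Bool) → Set
W ∈[ Q ] vs = Any (W ≈[ Q ]_) vs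

∈[]-resp : W₁ ≈[ Q ] W₂ → W₂ ∈[ Q ] vs → W₁ ∈[ Q ] vs
∈[]-resp e = Any.map (≈-trans e)

∈⇒∈[] : W ≈[ Q ] v → v ∈ vs → W ∈[ Q ] vs
∈⇒∈[] e v∈ = lose v∈ e

[≔]-agrees : (q ≢ p → W q ≡ v q) → (W [ p ≔ v p ]) q ≡ v q
[≔]-agrees {q} {p} {v = v} h with q ≡ᵇ p in eq
... | true  = cong v (sym (≡ᵇ-true⇒≡ eq))
... | false = h (≡ᵇ-false⇒≢ eq)

⊨-⋀⁻ : ∀ {s} → M , s ⊨ ⋀ φs → All (M , s ⊨_) φs
⊨-⋀⁻ {φs = []}    _        = []
⊨-⋀⁻ {φs = _ ∷ _} (h , hs) = h ∷ ⊨-⋀⁻ hs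

⊨-⋀⁺ : ∀ {s} → All (M , s ⊨_) φs → M , s ⊨ ⋀ φs
⊨-⋀⁺ []       = tt
⊨-⋀⁺ (h ∷ hs) = h , ⊨-⋀⁺ hs

⊨-⋁⁻ : ∀ {s} → M , s ⊨ ⋁ φs → Any (M , s ⊨_) φs
⊨-⋁⁻ {φs = []}    ()
⊨-⋁⁻ {φs = _ ∷ _} (inj₁ h) = here h
⊨-⋁⁻ {φs = _ ∷ _} (inj₂ h) = there (⊨-⋁⁻ h)

⊨-⋁⁺ : ∀ {s} → Any (M , s ⊨_) φs → M , s ⊨ ⋁ φs
⊨-⋁⁺ (here h)  = inj₁ h
⊨-⋁⁺ (there h) = inj₂ (⊨-⋁⁺ h)

⊨-d1Formula⁻ : ∀ {s} → M , s ⊨ d1Formula δ₀ Φ →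
               (M , s ⊨ δ₀) × (∀ {B} → Nonempty B → M , s ⊨ ∇ B (Φ B))
⊨-d1Formula⁻ (h₀ , h) = h₀ , λ ne → All.lookup (Allₚ.map⁻ (⊨-⋀⁻ h)) (∈-nonemptySubsets ne)

⊨-d1Formula⁺ : ∀ {s} → M , s ⊨ δ₀ → (∀ {B} → Nonempty B → M , s ⊨ ∇ B (Φ B)) →
               M , s ⊨ d1Formula δ₀ Φ
⊨-d1Formula⁺ h₀ h = h₀ , ⊨-⋀⁺ (Allₚ.map⁺ (All.tabulate (h ∘ nonemptySubsets-nonempty)))

⊨-literal⁻ : ∀ {s} b → M , s ⊨ literal b q → V M s q ≡ b
⊨-literal⁻ true  h = h
⊨-literal⁻ false h = ¬-not h

⊨-literal⁺ : ∀ {s} b → V M s q ≡ b → M , s ⊨ literal b q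
⊨-literal⁺ true  e = e
⊨-literal⁺ false e = not-¬ e

literal-^ᵖ-≢ : q ≢ p → literal {n} b q ^ᵖ p ≡ literal b q
literal-^ᵖ-≢ {b = true}  q≢p rewrite ≢⇒≡ᵇ-false q≢p = refl
literal-^ᵖ-≢ {b = false} q≢p rewrite ≢⇒≡ᵇ-false q≢p = refl

⊨-literal-^ᵖ⁻ : ∀ {s} b → M , s ⊨ (literal b q ^ᵖ p) → q ≢ p → V M s q ≡ b
⊨-literal-^ᵖ⁻ {M = M} {s = s} b h q≢p = ⊨-literal⁻ b (subst (M , s ⊨_) (literal-^ᵖ-≢ q≢p) h)

⊨-literal-^ᵖ⁺ : ∀ {s} b → (q ≢ p → V M s q ≡ b) → M , s ⊨ (literal b q ^ᵖ p)
⊨-literal-^ᵖ⁺ {q = q} {p = p} true h with q ≡ᵇ p in eq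
... | true  = tt
... | false = h (≡ᵇ-false⇒≢ eq)
⊨-literal-^ᵖ⁺ {q = q} {p = p} false h with q ≡ᵇ p in eq
... | true  = tt
... | false = not-¬ (h (≡ᵇ-false⇒≢ eq))

⊨-minterm⁻ : ∀ {s} → M , s ⊨ minterm Q v → V M s ≈[ Q ] v
⊨-minterm⁻ {Q = []}    _        = []
⊨-minterm⁻ {Q = _ ∷ _} {v = v} (h , hs) = ⊨-literal⁻ (v _) h ∷ ⊨-minterm⁻ hs

⊨-minterm⁺ : ∀ {s} → V M s ≈[ Q ] v → M , s ⊨ minterm Q v
⊨-minterm⁺ []                = tt
⊨-minterm⁺ {v = v} (e ∷ es) = ⊨-literal⁺ (v _) e , ⊨-minterm⁺ es

⊨-minterm-^ᵖ⁻ : ∀ {s} → M , s ⊨ (minterm Q v ^ᵖ p) → V M s [ p ≔ v p ] ≈[ Q ] v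
⊨-minterm-^ᵖ⁻ {Q = []}    _        = []
⊨-minterm-^ᵖ⁻ {M = M} {Q = _ ∷ _} {v = v} {s = s} (h , hs) =
  [≔]-agrees {W = V M s} (⊨-literal-^ᵖ⁻ (v _) h) ∷ ⊨-minterm-^ᵖ⁻ hs

∇-Sat : (M : Model n) → S M → Subset n → (S M → (ℕ → Bool) → Set) → List (ℕ → Bool) → Set
∇-Sat M s B match vs =
  (∀ t → RG M B s t → Any (match t) vs) × All (λ v → ∃ λ t → RG M B s t × match t v) vs

⊨-∇-map⁻ : ∀ {s} (f : (ℕ → Bool) → Formula n) {match} → (∀ {t v} → M , t ⊨ f v → match t v) →
           M , s ⊨ ∇ B (map f vs) → ∇-Sat M s B match vs
⊨-∇-map⁻ {vs = vs} f g (□ , ◇) =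
  (λ t r → Any.map g (Anyₚ.map⁻ (⊨-⋁⁻ {φs = map f vs} (□ t r)))) ,
  All.map (Product.map₂ (Product.map₂ g)) (Allₚ.map⁻ (Allₚ.map⁻ (⊨-⋀⁻ ◇)))

⊨-∇-map⁺ : ∀ {s} (f : (ℕ → Bool) → Formula n) {match} → (∀ {t v} → match t v → M , t ⊨ f v) →
           ∇-Sat M s B match vs → M , s ⊨ ∇ B (map f vs)
⊨-∇-map⁺ f g (□ , ◇) =
  (λ t r → ⊨-⋁⁺ (Anyₚ.map⁺ (Any.map g (□ t r)))) ,
  ⊨-⋀⁺ (Allₚ.map⁺ (Allₚ.map⁺ (All.map (Product.map₂ (Product.map₂ g)) ◇)))

⋀-^ᵖ : ∀ p (φs : List (Formula n)) → ⋀ φs ^ᵖ p ≡ ⋀ (map (_^ᵖ p) φs)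
⋀-^ᵖ p []       = refl
⋀-^ᵖ p (φ ∷ φs) = cong (φ ^ᵖ p ∧_) (⋀-^ᵖ p φs)

⋁-^ᵖ : ∀ p (φs : List (Formula n)) → ⋁ φs ^ᵖ p ≡ ⋁ (map (_^ᵖ p) φs)
⋁-^ᵖ p []       = refl
⋁-^ᵖ p (φ ∷ φs) = cong (φ ^ᵖ p ∨_) (⋁-^ᵖ p φs)

⋀D̂-^ᵖ : ∀ p B (φs : List (Formula n)) → ⋀ (map (D̂ B) φs) ^ᵖ p ≡ ⋀ (map (D̂ B) (map (_^ᵖ p) φs))
⋀D̂-^ᵖ p B []       = refl
⋀D̂-^ᵖ p B (φ ∷ φs) = cong (D̂ B (φ ^ᵖ p) ∧_) (⋀D̂-^ᵖ p B φs)

∇-^ᵖ : ∀ p B (φs : List (Formula n)) → ∇ B φs ^ᵖ p ≡ ∇ B (map (_^ᵖ p) φs)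
∇-^ᵖ p B φs = cong₂ (λ φ ψ → D B φ ∧ ψ) (⋁-^ᵖ p φs) (⋀D̂-^ᵖ p B φs)

d1Formula-^ᵖ : ∀ p (δ₀ : Formula n) Φ →
               d1Formula δ₀ Φ ^ᵖ p ≡ d1Formula (δ₀ ^ᵖ p) (map (_^ᵖ p) ∘ Φ)
d1Formula-^ᵖ {n} p δ₀ Φ = cong (δ₀ ^ᵖ p ∧_) (begin
  ⋀ (map (λ B → ∇ B (Φ B)) Bs) ^ᵖ p           ≡⟨ ⋀-^ᵖ p (map (λ B → ∇ B (Φ B)) Bs) ⟩
  ⋀ (map (_^ᵖ p) (map (λ B → ∇ B (Φ B)) Bs))  ≡⟨ cong ⋀ (sym (map-∘ Bs)) ⟩
  ⋀ (map (λ B → ∇ B (Φ B) ^ᵖ p) Bs)           ≡⟨ cong ⋀ (map-cong (λ B → ∇-^ᵖ p B (Φ B)) Bs) ⟩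
  ⋀ (map (λ B → ∇ B (map (_^ᵖ p) (Φ B))) Bs)  ∎)
  where
  open ≡-Reasoning
  Bs = nonemptySubsets n

d1Formula-cong : ∀ {n} {δ₀ : Formula n} {Φ Ψ} →
                 (∀ B → Φ B ≡ Ψ B) → d1Formula δ₀ Φ ≡ d1Formula δ₀ Ψ
d1Formula-cong {n} {δ₀} Φ≗Ψ =
  cong (δ₀ ∧_) (cong ⋀ (map-cong (λ B → cong (∇ B) (Φ≗Ψ B)) (nonemptySubsets n)))

d1Formulaᵛ : List ℕ → (ℕ → Bool) → (Subset n → List (ℕ → Bool)) → Formula n
d1Formulaᵛ P v₀ Vs = d1Formula (minterm P v₀) (map (minterm P) ∘ Vs)

valuations : ∀ {n P} {φs : List (Formula n)} → All (IsMinterm P) φs → List (ℕ → Bool)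
valuations []             = []
valuations {P = P} ((v , _) ∷ ms) = v ∷ valuations {P = P} ms

map-minterm-valuations : ∀ {n P} {φs : List (Formula n)} (ms : All (IsMinterm P) φs) →
                         map (minterm P) (valuations {P = P} ms) ≡ φs
map-minterm-valuations []                = refl
map-minterm-valuations {P = P} ((_ , refl) ∷ ms) = cong (_ ∷_) (map-minterm-valuations {P = P} ms)

InD1⇒d1Formulaᵛ : ∀ {P} {δ : Formula n} → InD1 P δ → ∃₂ λ v₀ Vs → δ ≡ d1Formulaᵛ P v₀ Vs
InD1⇒d1Formulaᵛ {P = P} (_ , _ , (v₀ , refl) , ms , refl) =
  v₀ , (λ B → valuations {P = P} (ms B)) , d1Formula-cong (λ B → sym (map-minterm-valuations {P = P} (ms B)))

occurs-^ᵖ : ∀ (φ : Formula n) → Occurs q (φ ^ᵖ p) → Occurs q φ × q ≢ p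
occurs-^ᵖ {p = p} (atom r) o with r ≡ᵇ p in eq
occurs-^ᵖ (atom r) ()   | true
occurs-^ᵖ (atom r) here | false = here , ≡ᵇ-false⇒≢ eq
occurs-^ᵖ {p = p} (¬ᶠ atom r) o with r ≡ᵇ p in eq
occurs-^ᵖ (¬ᶠ atom r) ()         | true
occurs-^ᵖ (¬ᶠ atom r) (neg here) | false = neg here , ≡ᵇ-false⇒≢ eq
occurs-^ᵖ (¬ᶠ ⊤ᶠ)      (neg ())
occurs-^ᵖ (¬ᶠ ⊥ᶠ)      (neg ())
occurs-^ᵖ (¬ᶠ (¬ᶠ φ))  (neg o) = map₁ neg (occurs-^ᵖ (¬ᶠ φ) o)
occurs-^ᵖ (¬ᶠ (φ ∧ ψ)) (neg o) = map₁ neg (occurs-^ᵖ (φ ∧ ψ) o)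
occurs-^ᵖ (¬ᶠ (φ ∨ ψ)) (neg o) = map₁ neg (occurs-^ᵖ (φ ∨ ψ) o)
occurs-^ᵖ (¬ᶠ D B φ)   (neg o) = map₁ neg (occurs-^ᵖ (D B φ) o)
occurs-^ᵖ (¬ᶠ D̂ B φ)   (neg o) = map₁ neg (occurs-^ᵖ (D̂ B φ) o)
occurs-^ᵖ (φ ∧ ψ) (andˡ o) = map₁ andˡ (occurs-^ᵖ φ o)
occurs-^ᵖ (φ ∧ ψ) (andʳ o) = map₁ andʳ (occurs-^ᵖ ψ o)
occurs-^ᵖ (φ ∨ ψ) (orˡ o)  = map₁ orˡ (occurs-^ᵖ φ o)
occurs-^ᵖ (φ ∨ ψ) (orʳ o)  = map₁ orʳ (occurs-^ᵖ ψ o)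
occurs-^ᵖ (D B φ) (box o)  = map₁ box (occurs-^ᵖ φ o)
occurs-^ᵖ (D̂ B φ) (dia o)  = map₁ dia (occurs-^ᵖ φ o)

-- Modalities only over nonempty groups: a collective bisimulation says nothing about R_∅.
data NNF {n} : Formula n → Set where
  lit  : ∀ b q → NNF (literal b q)
  ⊤ⁿ   : NNF ⊤ᶠ
  ⊥ⁿ   : NNF ⊥ᶠ
  _∧ⁿ_ : ∀ {φ ψ} → NNF φ → NNF ψ → NNF (φ ∧ ψ)
  _∨ⁿ_ : ∀ {φ ψ} → NNF φ → NNF ψ → NNF (φ ∨ ψ)
  Dⁿ   : ∀ {B φ} → Nonempty B → NNF φ → NNF (D B φ)
  D̂ⁿ   : ∀ {B φ} → Nonempty B → NNF φ → NNF (D̂ B φ)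

nnf-⋀ : All NNF φs → NNF (⋀ φs)
nnf-⋀ []       = ⊤ⁿ
nnf-⋀ (a ∷ as) = a ∧ⁿ nnf-⋀ as

nnf-⋁ : All NNF φs → NNF (⋁ φs)
nnf-⋁ []       = ⊥ⁿ
nnf-⋁ (a ∷ as) = a ∨ⁿ nnf-⋁ as

nnf-minterm : ∀ Q (v : ℕ → Bool) → NNF {n} (minterm Q v)
nnf-minterm []      v = ⊤ⁿ
nnf-minterm (q ∷ Q) v = lit (v q) q ∧ⁿ nnf-minterm Q v

nnf-∇ : Nonempty B → All NNF φs → NNF (∇ B φs)
nnf-∇ ne as = Dⁿ ne (nnf-⋁ as) ∧ⁿ nnf-⋀ (Allₚ.map⁺ (All.map (D̂ⁿ ne) as))

nnf-d1Formulaᵛ : ∀ P v₀ (Vs : Subset n → List (ℕ → Bool)) → NNF (d1Formulaᵛ P v₀ Vs)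
nnf-d1Formulaᵛ P v₀ Vs = nnf-minterm P v₀ ∧ⁿ nnf-⋀ (Allₚ.map⁺ (All.tabulate λ {B} B∈ →
  nnf-∇ (nonemptySubsets-nonempty B∈) (Allₚ.map⁺ (All.universal (nnf-minterm P) (Vs B)))))

module _ {p} {M M' : Model n} {s s'} (bisim : CollBisim p M M' s s') where
  open CollBisim bisim

  ^ᵖ-preserved : ∀ {φ u u'} → NNF φ → ρ u u' → M , u ⊨ φ → M' , u' ⊨ (φ ^ᵖ p)
  ^ᵖ-preserved (lit b q) r h = ⊨-literal-^ᵖ⁺ b (λ q≢p → trans (sym (atoms r q q≢p)) (⊨-literal⁻ b h))
  ^ᵖ-preserved ⊤ⁿ        r _ = tt
  ^ᵖ-preserved (a ∧ⁿ c)  r (h₁ , h₂) = ^ᵖ-preserved a r h₁ , ^ᵖ-preserved c r h₂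
  ^ᵖ-preserved (a ∨ⁿ c)  r h = Sum.map (^ᵖ-preserved a r) (^ᵖ-preserved c r) h
  ^ᵖ-preserved (Dⁿ ne a) r h t' r' with back r _ ne t' r'
  ... | t , rt , ρtt' = ^ᵖ-preserved a ρtt' (h t rt)
  ^ᵖ-preserved (D̂ⁿ ne a) r (t , rt , h) with forth r _ ne t rt
  ... | t' , rt' , ρtt' = t' , rt' , ^ᵖ-preserved a ρtt' h

module _ {P : List ℕ} {v₀ : ℕ → Bool} {Vs : Subset n → List (ℕ → Bool)} {M : Model n} {s : S M} where

  ⊨-d1Formulaᵛ⁻ : M , s ⊨ d1Formulaᵛ P v₀ Vs →
                  (V M s ≈[ P ] v₀) × (∀ {B} → Nonempty B → ∇-Sat M s B (λ t v → V M t ≈[ P ] v) (Vs B))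
  ⊨-d1Formulaᵛ⁻ h = let h₀ , h∇ = ⊨-d1Formula⁻ {Φ = map (minterm P) ∘ Vs} h in
    ⊨-minterm⁻ h₀ , λ ne → ⊨-∇-map⁻ (minterm P) ⊨-minterm⁻ (h∇ ne)

  ⊨-d1Formulaᵛ⁺ : V M s ≈[ P ] v₀ →
                  (∀ {B} → Nonempty B → ∇-Sat M s B (λ t v → V M t ≈[ P ] v) (Vs B)) →
                  M , s ⊨ d1Formulaᵛ P v₀ Vs
  ⊨-d1Formulaᵛ⁺ h₀ h∇ = ⊨-d1Formula⁺ {Φ = map (minterm P) ∘ Vs} (⊨-minterm⁺ h₀)
                          (λ ne → ⊨-∇-map⁺ (minterm P) ⊨-minterm⁺ (h∇ ne))

  ⊨-d1Formulaᵛ-^ᵖ⁻ : ∀ {p} → M , s ⊨ (d1Formulaᵛ P v₀ Vs ^ᵖ p) →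
                     (V M s [ p ≔ v₀ p ] ≈[ P ] v₀) ×
                     (∀ {B} → Nonempty B → ∇-Sat M s B (λ t v → V M t [ p ≔ v p ] ≈[ P ] v) (Vs B))
  ⊨-d1Formulaᵛ-^ᵖ⁻ {p} h
    with ⊨-d1Formula⁻ {Φ = map (_^ᵖ p) ∘ map (minterm P) ∘ Vs}
           (subst (M , s ⊨_) (d1Formula-^ᵖ p (minterm P v₀) (map (minterm P) ∘ Vs)) h)
  ... | h₀ , h∇ = ⊨-minterm-^ᵖ⁻ h₀ , λ {B} ne → ⊨-∇-map⁻ (λ v → minterm P v ^ᵖ p) ⊨-minterm-^ᵖ⁻
                    (subst (M , s ⊨_) (cong (∇ B) (sym (map-∘ (Vs B)))) (h∇ ne))

module _ {P : List ℕ} {v₀ : ℕ → Bool} {Vs : Subset n → List (ℕ → Bool)} {N : Model n} {t₀ : S N}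
         (N⊨δ : N , t₀ ⊨ d1Formulaᵛ P v₀ Vs) where

  private
    t₀≈v₀ : V N t₀ ≈[ P ] v₀
    t₀≈v₀ = proj₁ (⊨-d1Formulaᵛ⁻ {Vs = Vs} N⊨δ)

    N⊨∇ : Nonempty B → ∇-Sat N t₀ B (λ t v → V N t ≈[ P ] v) (Vs B)
    N⊨∇ = proj₂ (⊨-d1Formulaᵛ⁻ {Vs = Vs} N⊨δ)

  Φ-antitone : ∀ {C G} → Nonempty C → C ⊆ G → W ∈[ P ] Vs G → W ∈[ P ] Vs C
  Φ-antitone (i , i∈C) C⊆G W∈ with find W∈
  ... | v , v∈ , W≈v with All.lookup (proj₂ (N⊨∇ (i , C⊆G i∈C))) v∈
  ...   | t , r , t≈v =
    ∈[]-resp (≈-trans W≈v (≈-sym t≈v)) (proj₁ (N⊨∇ (i , i∈C)) t (λ j → r j ∘ C⊆G))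

  reflexive⇒v₀∈Φ : Reflexive N → Nonempty B → v₀ ∈[ P ] Vs B
  reflexive⇒v₀∈Φ refl-N ne =
    ∈[]-resp (≈-sym t₀≈v₀) (proj₁ (N⊨∇ ne) t₀ (λ i _ → refl-N i t₀))

BisimilarModel : Logic → ℕ → Formula n → (M' : Model n) → S M' → Set₁
BisimilarModel {n} L p φ M' s' =
  Σ (Model n) λ M → Σ (S M) λ s → IsModelOf L M × (M , s ⊨ φ) × CollBisim p M M' s s'

lookup-∩ : ∀ {C G : Subset n} {i} → i ∈ₛ C → lookup (C ∩ G) i ≡ lookup G i
lookup-∩ {C = C} {G} {i} i∈C rewrite lookup-zipWith _∧ᵇ_ i C G | []=⇒lookup i∈C = refl

module Lifting (P : List ℕ) (p : ℕ) (v₀ : ℕ → Bool) (Vs : Subset n → List (ℕ → Bool))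
  (antitone : ∀ {C G W} → Nonempty C → C ⊆ G → W ∈[ P ] Vs G → W ∈[ P ] Vs C)
  (M' : Model n) (s' : S M') (trans' : Transitive M') (eucl' : Euclidean M')
  (M'⊨δ^p : M' , s' ⊨ (d1Formulaᵛ P v₀ Vs ^ᵖ p)) (Ok : Set) where

  s'≈v₀ : V M' s' [ p ≔ v₀ p ] ≈[ P ] v₀
  s'≈v₀ = proj₁ (⊨-d1Formulaᵛ-^ᵖ⁻ {Vs = Vs} M'⊨δ^p)

  private
    M'⊨∇ : Nonempty B → ∇-Sat M' s' B (λ t v → V M' t [ p ≔ v p ] ≈[ P ] v) (Vs B)
    M'⊨∇ = proj₂ (⊨-d1Formulaᵛ-^ᵖ⁻ {Vs = Vs} M'⊨δ^p)

    reset-p : ∀ {G y} → Nonempty G → RG M' G s' y → ∃ λ b → V M' y [ p ≔ b ] ∈[ P ] Vs G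
    reset-p ne r with find (proj₁ (M'⊨∇ ne) _ r)
    ... | v , v∈ , y≈v = v p , ∈⇒∈[] y≈v v∈

  -- A copy of y: the root (y = s', present only if Ok), an untouched copy, or y viewed as an
  -- R'_G-successor of s' with p set to b.
  data Tag (y : S M') : Set where
    root : y ≡ s' → Ok → Tag y
    base : Tag y
    succ : (G : Subset n) → Nonempty G → RG M' G s' y →
           (b : Bool) → V M' y [ p ≔ b ] ∈[ P ] Vs G → Tag y

  succ⁺ : ∀ {G y} → Nonempty G → RG M' G s' y → Tag y
  succ⁺ {G} ne r = uncurry (succ G ne r) (reset-p ne r)

  mark : ∀ {y} → Tag y → Fin n → Bool
  mark (root _ _)       _ = true
  mark base             _ = false
  mark (succ G _ _ _ _) i = lookup G i

  p-value : ∀ {y} → Tag y → Bool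
  p-value (root _ _)       = v₀ p
  p-value {y} base         = V M' y p
  p-value (succ _ _ _ b _) = b

  -- The root is never a successor: its value of p is v₀ p, which need not fit any Φ_C.
  NonRoot : ∀ {y} → Tag y → Set
  NonRoot (root _ _) = ⊥
  NonRoot _          = Unit

  World : Set
  World = Σ (S M') Tag

  Edge : Fin n → World → World → Set
  Edge i (x , τ) (y , σ) = R M' i x y × NonRoot σ × mark τ i ≡ mark σ i

  valuation : World → ℕ → Bool
  valuation (x , τ) = V M' x [ p ≔ p-value τ ]

  Lifted : Model n
  Lifted = record { S = World ; R = Edge ; V = valuation }

  transitive : Transitive Lifted
  transitive i (x , _) (y , _) (z , _) (r₁ , _ , c₁) (r₂ , nr , c₂) =
    trans' i x y z r₁ r₂ , nr , trans c₁ c₂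

  euclidean : Euclidean Lifted
  euclidean i (x , _) (y , _) (z , _) (r₁ , _ , c₁) (r₂ , nr , c₂) =
    eucl' i x y z r₁ r₂ , nr , trans (sym c₁) c₂

  step-tag : ∀ {C x y} (τ : Tag x) → Nonempty C → RG M' C x y →
             Σ (Tag y) λ σ → NonRoot σ × (∀ {i} → i ∈ₛ C → mark τ i ≡ mark σ i)
  step-tag (root refl _) ne r = succ⁺ ne r , tt , sym ∘ []=⇒lookup
  step-tag base          _  _ = base , tt , λ _ → refl
  step-tag {C} {x} {y} (succ G _ rG _ _) _ r with nonempty? (C ∩ G)
  ... | yes ne∩ = succ⁺ ne∩ r∩ , tt , sym ∘ lookup-∩
    where
    r∩ : RG M' (C ∩ G) s' y
    r∩ i i∈ = trans' i s' x y (rG i (p∩q⊆q C G i∈)) (r i (p∩q⊆p C G i∈))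
  ... | no ¬ne∩ = base , tt , λ {i} i∈C →
    ¬-not λ i∈G → ¬ne∩ (i , x∈p∩q⁺ (i∈C , lookup⇒[]= i G i∈G))

  serial : Serial M' → Serial Lifted
  serial serial' i (x , τ) with serial' i x
  ... | y , r with step-tag τ (i , x∈⁅x⁆ i) (R⇒RG-⁅⁆ {M = M'} r)
  ...   | σ , nr , c = (y , σ) , r , nr , c (x∈⁅x⁆ i)

  reflexive : Reflexive M' → ¬ Ok → Reflexive Lifted
  reflexive _     ¬ok _ (_ , root _ ok)      = ⊥-elim (¬ok ok)
  reflexive refl' _   i (x , base)           = refl' i x , tt , refl
  reflexive refl' _   i (x , succ _ _ _ _ _) = refl' i x , tt , refl

  projection : (τ : Tag s') → CollBisim p Lifted M' (s' , τ) s'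
  projection τ = record
    { ρ     = λ w x → proj₁ w ≡ x
    ; start = refl
    ; atoms = λ { {x , _} refl q q≢p → [≔]-≢ {W = V M' x} q≢p }
    ; forth = λ { refl _ _ (y , _) r → y , (λ i i∈ → proj₁ (r i i∈)) , refl }
    ; back  = λ { {_ , τ} refl _ ne y r → let σ , nr , c = step-tag τ ne r in
                    (y , σ) , (λ i i∈ → r i i∈ , nr , c i∈) , refl }
    }

  ⊨-d1Formulaᵛ : (τ : Tag s') → p-value τ ≡ v₀ p → (∀ i → mark τ i ≡ true) →
                 Lifted , (s' , τ) ⊨ d1Formulaᵛ P v₀ Vs
  ⊨-d1Formulaᵛ τ p≡ marked =
    ⊨-d1Formulaᵛ⁺ {Vs = Vs} (subst (λ b → V M' s' [ p ≔ b ] ≈[ P ] v₀) (sym p≡) s'≈v₀)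
                            (λ ne → □ ne , ◇ ne)
    where
    □ : Nonempty B → ∀ t → RG Lifted B (s' , τ) t → valuation t ∈[ P ] Vs B
    □ (i , i∈B) (_ , root _ _) r = ⊥-elim (proj₁ (proj₂ (r i i∈B)))
    □ (i , i∈B) (_ , base) r with () ← trans (sym (marked i)) (proj₂ (proj₂ (r i i∈B)))
    □ {B} ne (_ , succ G _ _ _ y∈Φ) r = antitone ne B⊆G y∈Φ
      where
      B⊆G : B ⊆ G
      B⊆G {i} i∈B = lookup⇒[]= i G (trans (sym (proj₂ (proj₂ (r i i∈B)))) (marked i))

    ◇ : Nonempty B → All (λ v → ∃ λ t → RG Lifted B (s' , τ) t × valuation t ≈[ P ] v) (Vs B)
    ◇ ne = All.tabulate λ {v} v∈ → let y , r , y≈v = All.lookup (proj₂ (M'⊨∇ ne)) v∈ in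
      (y , succ _ ne r (v p) (∈⇒∈[] y≈v v∈)) ,
      (λ i i∈ → r i i∈ , tt , trans (marked i) (sym ([]=⇒lookup i∈))) ,
      y≈v

  lifts-at : ∀ L (τ : Tag s') → p-value τ ≡ v₀ p → (∀ i → mark τ i ≡ true) → IsModelOf L Lifted →
             BisimilarModel L p (d1Formulaᵛ P v₀ Vs) M' s'
  lifts-at _ τ p≡ marked L-model = Lifted , (s' , τ) , L-model , ⊨-d1Formulaᵛ τ p≡ marked , projection τ

bisimilar-model : ∀ (L : Logic) P p v₀ (Vs : Subset n → List (ℕ → Bool)) →
                  Satisfiable L (d1Formulaᵛ P v₀ Vs) →
                  ∀ (M' : Model n) s' → IsModelOf L M' → M' , s' ⊨ (d1Formulaᵛ P v₀ Vs ^ᵖ p) →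
                  BisimilarModel L p (d1Formulaᵛ P v₀ Vs) M' s'
bisimilar-model K45nD P p v₀ Vs (_ , _ , _ , N⊨δ) M' s' (trans' , eucl') M'⊨δ^p =
  lifts-at K45nD (root refl tt) refl (λ _ → refl) (transitive , euclidean)
  where open Lifting P p v₀ Vs (Φ-antitone N⊨δ) M' s' trans' eucl' M'⊨δ^p Unit
bisimilar-model KD45nD P p v₀ Vs (_ , _ , _ , N⊨δ) M' s' (serial' , trans' , eucl') M'⊨δ^p =
  lifts-at KD45nD (root refl tt) refl (λ _ → refl) (serial serial' , transitive , euclidean)
  where open Lifting P p v₀ Vs (Φ-antitone N⊨δ) M' s' trans' eucl' M'⊨δ^p Unit
bisimilar-model {zero} S5nD P p v₀ Vs (_ , _ , _ , N⊨δ) M' s' (_ , trans' , eucl') M'⊨δ^p =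
  lifts-at S5nD (root refl tt) refl (λ _ → refl) ((λ ()) , transitive , euclidean)
  where open Lifting P p v₀ Vs (Φ-antitone N⊨δ) M' s' trans' eucl' M'⊨δ^p Unit
-- With agents present the root has no reflexive loops; instead s' is used as an R'_full-successor of itself.
bisimilar-model {suc _} S5nD P p v₀ Vs (_ , (refl-N , _) , _ , N⊨δ) M' s' (refl' , trans' , eucl') M'⊨δ^p =
  lifts-at S5nD s'-full refl (λ i → lookup-replicate i true) (reflexive refl' id , transitive , euclidean)
  where
  open Lifting P p v₀ Vs (Φ-antitone N⊨δ) M' s' trans' eucl' M'⊨δ^p ⊥
  full-ne : Nonempty full
  full-ne = zero , ∈⊤
  s'-full : Tag s'
  s'-full = succ full full-ne (λ i _ → refl' i s') (v₀ p)
                 (∈[]-resp s'≈v₀ (reflexive⇒v₀∈Φ {Vs = Vs} N⊨δ refl-N full-ne))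

d1Formulaᵛ-forgetting : ∀ (L : Logic) P p v₀ (Vs : Subset n → List (ℕ → Bool)) →
  Satisfiable L (d1Formulaᵛ P v₀ Vs) → IsForgetting L p (d1Formulaᵛ P v₀ Vs) (d1Formulaᵛ P v₀ Vs ^ᵖ p)
d1Formulaᵛ-forgetting L P p v₀ Vs sat =
  (λ _ → occurs-^ᵖ (d1Formulaᵛ P v₀ Vs)) ,
  (λ _ _ _ _ _ M⊨δ _ bisim → ^ᵖ-preserved bisim (nnf-d1Formulaᵛ P v₀ Vs) (CollBisim.start bisim) M⊨δ) ,
  bisimilar-model L P p v₀ Vs sat

corollary5p17 : ∀ {n : ℕ} (L : Logic) (P : List ℕ) (p : ℕ) → p ∈ P →
    (δ : Formula n) → InD1L L P δ → IsForgetting L p δ (δ ^ᵖ p)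
corollary5p17 L P p _ δ (δ∈D₁ , sat) with InD1⇒d1Formulaᵛ {P = P} δ∈D₁
... | v₀ , Vs , refl = d1Formulaᵛ-forgetting L P p v₀ Vs sat
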